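{- Let $n_1>\dots>n_k$ and $m_1>\dots>m_\ell$ be positive integers with $(n_1,\dots,n_k)\succ(m_1,\dots,m_\ell)$. If $F_{2n_1}F_{2n_2}\cdots F_{2n_k}=F_{2m_1}F_{2m_2}\cdots F_{2m_\ell}$, then $k=\ell$ and $m_i=n_i$ for all $i$.
   Context: $F_n$ is the Fibonacci sequence with $F_0=1$, $F_1=1$, $F_{n+2}=F_{n+1}+F_n$ for $n\ge0$. Majorization: for finite non-increasing sequences of positive integers $(a_1,\dots,a_n)$ and $(b_1,\dots,b_k)$, write $(a_1,\dots,a_n)\succ(b_1,\dots,b_k)$ if: (1) $n\le k$; (2) for every $i\le n$, $a_1+\dots+a_i\ge b_1+\dots+b_i$; (3) $a_1+\dots+a_n\ge b_1+\dots+b_k$. -}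

module Defs where

open import Data.Nat using (ℕ; zero; suc; _+_; _*_; _≤_; _<_; _>_)
open import Data.List using (List; []; _∷_; length; map; take)
open import Data.Nat.ListAction using (sum; product)
open import Data.List.Relation.Unary.All using (All)
open import Data.List.Relation.Unary.Linked using (Linked)
open import Data.Product using (_×_)

fib : ℕ → ℕ
fib zero = 1
fib (suc zero) = 1
fib (suc (suc n)) = fib (suc n) + fib n

StrictDecPos : List ℕ → Set
StrictDecPos xs = All (λ x → 0 < x) xs × Linked _>_ xs

_≻_ : List ℕ → List ℕ → Set
as ≻ bs = (length as ≤ length bs)
        × (∀ i → i ≤ length as → sum (take i bs) ≤ sum (take i as))
        × (sum bs ≤ sum as)

fibEvenProd : List ℕ → ℕ
fibEvenProd xs = product (map (λ x → fib (2 * x)) xs)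

-- Write φ x = fib (2x) = F (2x+1), where F is the usual Fibonacci sequence (F 0 = 0).  Vajda's
-- identity at the odd index 2x+1 reads φ (x+i+j) φ x = φ (x+i) φ (x+j) + F (2i) F (2j), so φ is log-convex:
-- φ b φ (x+d) ≤ φ (b+d) φ x for x ≤ b, strictly if x < b and d > 0.  A Karamata-type induction
-- follows: if the prefix sums of a dominate those of a nonincreasing list b, write a₁ = b₁ + d
-- and add d to the first later entry of a that is at most b₁.  By log-convexity this does not
-- increase Π φ, and the new tail of a still dominates the tail of b; hence Π φ(b) ≤ Π φ(a),
-- strictly when the head of a exceeds that of b.  Under n ≻ m equal products therefore force
-- n₁ = m₁, and cancelling φ n₁ lets the argument repeat on the tails.
module Submission where

open import Defs
open import Data.Nat
open import Data.Nat.Properties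
open import Data.Nat.ListAction using (sum)
open import Data.Nat.Tactic.RingSolver using (solve-∀)
open import Data.List using (List; []; _∷_; _++_; length; take; drop)
open import Data.List.Properties using (take-all; take++drop≡id)
open import Data.Nat.ListAction.Properties using (sum-++)
open import Data.List.Relation.Unary.All using (All; []; _∷_)
open import Data.List.Relation.Unary.AllPairs as AllPairs using (AllPairs; []; _∷_)
open import Data.List.Relation.Unary.Linked as Linked using (Linked)
open import Data.List.Relation.Unary.Linked.Properties using (Linked⇒AllPairs)
open import Data.Product using (_,_)
open import Data.Sum using (_⊎_; inj₁; inj₂)
open import Data.Empty using (⊥-elim)
open import Function using (flip)
open import Relation.Nullary using (yes; no)
open import Relation.Binary.PropositionalEquality
import Algebra.Properties.CommutativeSemigroup as CommutativeSemigroupProperties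
open CommutativeSemigroupProperties +-commutativeSemigroup using () renaming (x∙yz≈y∙xz to +-exchange)
open CommutativeSemigroupProperties *-commutativeSemigroup using () renaming (x∙yz≈y∙xz to *-exchange)

F : ℕ → ℕ
F zero = 0
F (suc zero) = 1
F (suc (suc n)) = F (suc n) + F n

fib≡F-suc : ∀ n → fib n ≡ F (suc n)
fib≡F-suc zero = refl
fib≡F-suc (suc zero) = refl
fib≡F-suc (suc (suc n)) = cong₂ _+_ (fib≡F-suc (suc n)) (fib≡F-suc n)

evenBit : ℕ → ℕ
evenBit zero = 1
evenBit (suc zero) = 0
evenBit (suc (suc n)) = evenBit n

evenBit-even : ∀ x → evenBit (2 * x) ≡ 1
evenBit-even zero = refl
evenBit-even (suc x) = trans (cong evenBit (*-suc 2 x)) (evenBit-even x)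

evenBit-odd : ∀ x → evenBit (suc (2 * x)) ≡ 0
evenBit-odd zero = refl
evenBit-odd (suc x) = trans (cong (λ n → evenBit (suc n)) (*-suc 2 x)) (evenBit-odd x)

cassini : ∀ n → F n * F (2 + n) + evenBit n ≡ F (1 + n) * F (1 + n) + evenBit (1 + n)
cassini zero = refl
cassini (suc n) = begin
  Y * ((Y + X) + Y) + evenBit (suc n)     ≡⟨ expand Y X _ ⟩
  Y * (Y + X) + (Y * Y + evenBit (suc n)) ≡⟨ cong (Y * (Y + X) +_) (sym (cassini n)) ⟩
  Y * (Y + X) + (X * (Y + X) + evenBit n) ≡⟨ collect Y X _ ⟩
  (Y + X) * (Y + X) + evenBit n           ∎
  where
  open ≡-Reasoning
  X = F n
  Y = F (suc n)
  expand : ∀ y x p → y * ((y + x) + y) + p ≡ y * (y + x) + (y * y + p)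
  expand = solve-∀
  collect : ∀ y x p → y * (y + x) + (x * (y + x) + p) ≡ (y + x) * (y + x) + p
  collect = solve-∀

FibonacciLike : (ℕ → ℕ) → Set
FibonacciLike s = ∀ n → s (2 + n) ≡ s (1 + n) + s n

fibonacciLike-linear : ∀ {s t} c d → FibonacciLike s → FibonacciLike t →
  FibonacciLike (λ n → c * s n + d * t n)
fibonacciLike-linear {s} {t} c d s-rec t-rec n rewrite s-rec n | t-rec n =
  split c (s (1 + n)) (s n) d (t (1 + n)) (t n)
  where
  split : ∀ a x y b u v → a * (x + y) + b * (u + v) ≡ (a * x + b * u) + (a * y + b * v)
  split = solve-∀

fibonacciLike-unique : ∀ {s t} → FibonacciLike s → FibonacciLike t → s 0 ≡ t 0 → s 1 ≡ t 1 →
  ∀ n → s n ≡ t n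
fibonacciLike-unique s-rec t-rec s0≡t0 s1≡t1 zero = s0≡t0
fibonacciLike-unique s-rec t-rec s0≡t0 s1≡t1 (suc zero) = s1≡t1
fibonacciLike-unique {s} {t} s-rec t-rec s0≡t0 s1≡t1 (suc (suc n)) = begin
  s (2 + n)         ≡⟨ s-rec n ⟩
  s (1 + n) + s n   ≡⟨ cong₂ _+_ (unique (suc n)) (unique n) ⟩
  t (1 + n) + t n   ≡⟨ t-rec n ⟨
  t (2 + n)         ∎
  where
  open ≡-Reasoning
  unique = fibonacciLike-unique {s} {t} s-rec t-rec s0≡t0 s1≡t1

-- Vajda's identity F a F (a+i+j) − F (a+i) F (a+j) = (−1)^(a+1) F i F j, with the
-- signed term moved to the side where it is nonnegative.
vajda₁ : ∀ a i → F a * F (suc (i + a)) + evenBit a * F i ≡ F (suc a) * F (i + a) + evenBit (suc a) * F i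
vajda₁ a = fibonacciLike-unique
  (fibonacciLike-linear (F a) (evenBit a) (λ _ → refl) (λ _ → refl))
  (fibonacciLike-linear (F (suc a)) (evenBit (suc a)) (λ _ → refl) (λ _ → refl))
  (cong₂ _+_ (*-comm (F a) (F (suc a))) (trans (*-zeroʳ (evenBit a)) (sym (*-zeroʳ (evenBit (suc a))))))
  (subst₂ (λ p q → F a * F (2 + a) + p ≡ F (1 + a) * F (1 + a) + q)
    (sym (*-identityʳ (evenBit a))) (sym (*-identityʳ (evenBit (suc a)))) (cassini a))

vajda : ∀ a i j → F a * F (j + (i + a)) + evenBit a * F i * F j ≡ F (i + a) * F (j + a) + evenBit (suc a) * F i * F j
vajda a i = fibonacciLike-unique
  (fibonacciLike-linear (F a) (evenBit a * F i) (λ _ → refl) (λ _ → refl))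
  (fibonacciLike-linear (F (i + a)) (evenBit (suc a) * F i) (λ _ → refl) (λ _ → refl))
  (cong₂ _+_ (*-comm (F a) (F (i + a))) (trans (*-zeroʳ (evenBit a * F i)) (sym (*-zeroʳ (evenBit (suc a) * F i)))))
  (begin
    F a * F (suc (i + a)) + evenBit a * F i * 1             ≡⟨ cong (F a * F (suc (i + a)) +_) (*-identityʳ _) ⟩
    F a * F (suc (i + a)) + evenBit a * F i                 ≡⟨ vajda₁ a i ⟩
    F (suc a) * F (i + a) + evenBit (suc a) * F i           ≡⟨ cong₂ _+_ (*-comm (F (suc a)) (F (i + a))) (sym (*-identityʳ _)) ⟩
    F (i + a) * F (suc a) + evenBit (suc a) * F i * 1       ∎)
  where open ≡-Reasoning

vajda-odd : ∀ x i j → let a = suc (2 * x) in F a * F (j + (i + a)) ≡ F (i + a) * F (j + a) + F i * F j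
vajda-odd x i j = begin
  F a * F (j + (i + a))                                ≡⟨ +-identityʳ _ ⟨
  F a * F (j + (i + a)) + 0                            ≡⟨ cong (λ e → F a * F (j + (i + a)) + e * F i * F j) (evenBit-odd x) ⟨
  F a * F (j + (i + a)) + evenBit a * F i * F j        ≡⟨ vajda a i j ⟩
  F (i + a) * F (j + a) + evenBit (suc a) * F i * F j  ≡⟨ cong (λ e → F (i + a) * F (j + a) + e * F i * F j) (evenBit-even x) ⟩
  F (i + a) * F (j + a) + 1 * F i * F j                ≡⟨ cong (λ e → F (i + a) * F (j + a) + e * F j) (*-identityˡ (F i)) ⟩
  F (i + a) * F (j + a) + F i * F j                    ∎
  where
  open ≡-Reasoning
  a = suc (2 * x)

fibEven : ℕ → ℕ
fibEven x = fib (2 * x)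

fibEven≡F : ∀ x → fibEven x ≡ F (suc (2 * x))
fibEven≡F x = fib≡F-suc (2 * x)

fibEven-vajda : ∀ x i j → fibEven (x + i + j) * fibEven x ≡ fibEven (x + i) * fibEven (x + j) + F (2 * i) * F (2 * j)
fibEven-vajda x i j = begin
  fibEven (x + i + j) * fibEven x                        ≡⟨ cong₂ _*_ (shift₂ x i j) (fibEven≡F x) ⟩
  F (2 * j + (2 * i + a)) * F a                          ≡⟨ *-comm _ (F a) ⟩
  F a * F (2 * j + (2 * i + a))                          ≡⟨ vajda-odd x (2 * i) (2 * j) ⟩
  F (2 * i + a) * F (2 * j + a) + F (2 * i) * F (2 * j)  ≡⟨ cong (_+ F (2 * i) * F (2 * j)) (cong₂ _*_ (shift x i) (shift x j)) ⟨
  fibEven (x + i) * fibEven (x + j) + F (2 * i) * F (2 * j) ∎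
  where
  open ≡-Reasoning
  a = suc (2 * x)
  shift : ∀ x i → fibEven (x + i) ≡ F (2 * i + suc (2 * x))
  shift x i = trans (fibEven≡F (x + i)) (cong F (index x i))
    where
    index : ∀ x i → suc (2 * (x + i)) ≡ 2 * i + suc (2 * x)
    index = solve-∀
  shift₂ : ∀ x i j → fibEven (x + i + j) ≡ F (2 * j + (2 * i + suc (2 * x)))
  shift₂ x i j = trans (fibEven≡F (x + i + j)) (cong F (index x i j))
    where
    index : ∀ x i j → suc (2 * (x + i + j)) ≡ 2 * j + (2 * i + suc (2 * x))
    index = solve-∀

F-suc-pos : ∀ n → 0 < F (suc n)
F-suc-pos zero = z<s
F-suc-pos (suc n) = ≤-trans (F-suc-pos n) (m≤m+n (F (suc n)) (F n))

F-even-pos : ∀ {e} → 0 < e → 0 < F (2 * e)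
F-even-pos {suc e} _ = subst (λ n → 0 < F n) (sym (*-suc 2 e)) (F-suc-pos (suc (2 * e)))

fibEven-pos : ∀ x → 0 < fibEven x
fibEven-pos x = subst (0 <_) (sym (fibEven≡F x)) (F-suc-pos (2 * x))

fibEven-≥2 : ∀ {x} → 0 < x → 2 ≤ fibEven x
fibEven-≥2 {suc x} _ = subst (2 ≤_) (sym (trans (fibEven≡F (suc x)) (cong (λ n → F (suc n)) (*-suc 2 x))))
  (+-mono-≤ (F-suc-pos (suc (2 * x))) (F-suc-pos (2 * x)))

fibEven-logConvex : ∀ {x b} d → x ≤ b → fibEven b * fibEven (x + d) ≤ fibEven (b + d) * fibEven x
fibEven-logConvex {x} d x≤b with m≤n⇒∃[o]m+o≡n x≤b
... | e , refl = begin
  fibEven (x + e) * fibEven (x + d)                         ≤⟨ m≤m+n _ _ ⟩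
  fibEven (x + e) * fibEven (x + d) + F (2 * e) * F (2 * d) ≡⟨ fibEven-vajda x e d ⟨
  fibEven (x + e + d) * fibEven x                           ∎
  where open ≤-Reasoning

fibEven-logConvex-strict : ∀ {x b d} → x < b → 0 < d → fibEven b * fibEven (x + d) < fibEven (b + d) * fibEven x
fibEven-logConvex-strict {x} {b} {d} x<b d>0 with m≤n⇒∃[o]m+o≡n (<⇒≤ x<b)
... | e , refl = begin-strict
  fibEven (x + e) * fibEven (x + d)                         <⟨ m<m+n _ (*-mono-≤ (F-even-pos e>0) (F-even-pos d>0)) ⟩
  fibEven (x + e) * fibEven (x + d) + F (2 * e) * F (2 * d) ≡⟨ fibEven-vajda x e d ⟨
  fibEven (x + e + d) * fibEven x                           ∎
  where
  open ≤-Reasoning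
  e>0 : 0 < e
  e>0 = +-cancelˡ-< x 0 e (subst (_< x + e) (sym (+-identityʳ x)) x<b)

fibEvenProd-pos : ∀ a → 0 < fibEvenProd a
fibEvenProd-pos [] = z<s
fibEvenProd-pos (x ∷ a) = *-mono-≤ (fibEven-pos x) (fibEvenProd-pos a)

head₀ : List ℕ → ℕ
head₀ [] = 0
head₀ (x ∷ _) = x

bump : ℕ → ℕ → List ℕ → List ℕ
bump b d [] = d ∷ []
bump b d (x ∷ xs) with x ≤? b
... | yes _ = x + d ∷ xs
... | no _ = x ∷ bump b d xs

fibEvenProd-bump : ∀ b d a → fibEven b * fibEvenProd (bump b d a) ≤ fibEven (b + d) * fibEvenProd a
fibEvenProd-bump b d [] =
  subst (λ p → fibEven b * p ≤ fibEven (b + d) * 1) (sym (*-identityʳ (fibEven d))) (fibEven-logConvex {b = b} d z≤n)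
fibEvenProd-bump b d (x ∷ a) with x ≤? b
... | yes x≤b = begin
  fibEven b * (fibEven (x + d) * fibEvenProd a) ≡⟨ *-assoc (fibEven b) _ _ ⟨
  fibEven b * fibEven (x + d) * fibEvenProd a   ≤⟨ *-monoˡ-≤ (fibEvenProd a) (fibEven-logConvex d x≤b) ⟩
  fibEven (b + d) * fibEven x * fibEvenProd a   ≡⟨ *-assoc (fibEven (b + d)) _ _ ⟩
  fibEven (b + d) * (fibEven x * fibEvenProd a) ∎
  where open ≤-Reasoning
... | no _ = begin
  fibEven b * (fibEven x * fibEvenProd (bump b d a))  ≡⟨ *-exchange (fibEven b) (fibEven x) _ ⟩
  fibEven x * (fibEven b * fibEvenProd (bump b d a))  ≤⟨ *-monoʳ-≤ (fibEven x) (fibEvenProd-bump b d a) ⟩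
  fibEven x * (fibEven (b + d) * fibEvenProd a)       ≡⟨ *-exchange (fibEven x) (fibEven (b + d)) _ ⟩
  fibEven (b + d) * (fibEven x * fibEvenProd a)       ∎
  where open ≤-Reasoning

-- Equality can only occur when the excess is added to an entry equal to b.
fibEvenProd-bump-strict : ∀ {b d} a → 0 < b → 0 < d →
  fibEven b * fibEvenProd (bump b d a) < fibEven (b + d) * fibEvenProd a ⊎ b < head₀ (bump b d a)
fibEvenProd-bump-strict {b} {d} [] b>0 d>0 = inj₁
  (subst (λ p → fibEven b * p < fibEven (b + d) * 1) (sym (*-identityʳ (fibEven d))) (fibEven-logConvex-strict b>0 d>0))
fibEvenProd-bump-strict {b} {d} (x ∷ a) b>0 d>0 with x ≤? b
... | no x≰b = inj₂ (≰⇒> x≰b)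
... | yes x≤b with m≤n⇒m<n∨m≡n x≤b
...   | inj₂ refl = inj₂ (m<m+n x d>0)
...   | inj₁ x<b = inj₁ (begin-strict
  fibEven b * (fibEven (x + d) * fibEvenProd a) ≡⟨ *-assoc (fibEven b) _ _ ⟨
  fibEven b * fibEven (x + d) * fibEvenProd a   <⟨ *-monoˡ-< (fibEvenProd a) {{>-nonZero (fibEvenProd-pos a)}} (fibEven-logConvex-strict x<b d>0) ⟩
  fibEven (b + d) * fibEven x * fibEvenProd a   ≡⟨ *-assoc (fibEven (b + d)) _ _ ⟩
  fibEven (b + d) * (fibEven x * fibEvenProd a) ∎)
  where open ≤-Reasoning

Dominates : List ℕ → List ℕ → Set
Dominates a b = ∀ i → sum (take i b) ≤ sum (take i a)

-- If the excess d has not been placed among the first i entries, each of them was skipped, so exceeds b.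
bump-prefix : ∀ b d a i → d + sum (take i a) ≤ sum (take i (bump b d a)) ⊎ i * b ≤ sum (take i (bump b d a))
bump-prefix b d a zero = inj₂ z≤n
bump-prefix b d [] (suc i) = inj₁ (+-monoʳ-≤ d z≤n)
bump-prefix b d (x ∷ xs) (suc i) with x ≤? b
... | yes _ = inj₁ (≤-reflexive (trans (+-exchange d x _) (sym (+-assoc x d _))))
... | no x≰b with bump-prefix b d xs i
...   | inj₁ h = inj₁ (subst (_≤ x + sum (take i (bump b d xs))) (+-exchange x d _) (+-monoʳ-≤ x h))
...   | inj₂ h = inj₂ (+-mono-≤ (<⇒≤ (≰⇒> x≰b)) h)

sum-take≤* : ∀ {b} ys i → All (_≤ b) ys → sum (take i ys) ≤ i * b
sum-take≤* ys zero _ = z≤n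
sum-take≤* [] (suc i) _ = z≤n
sum-take≤* (y ∷ ys) (suc i) (y≤b ∷ ys≤b) = +-mono-≤ y≤b (sum-take≤* ys i ys≤b)

dominates-bump : ∀ {b d a b′} → All (_≤ b) b′ → Dominates (b + d ∷ a) (b ∷ b′) → Dominates (bump b d a) b′
dominates-bump {b} {d} {a} {b′} b′≤b dom i with bump-prefix b d a i
... | inj₁ h = ≤-trans (+-cancelˡ-≤ b _ _ (subst (b + sum (take i b′) ≤_) (+-assoc b d _) (dom (suc i)))) h
... | inj₂ h = ≤-trans (sum-take≤* b′ i b′≤b) h

dominates-[]⇒dominates-[0] : ∀ {b} → Dominates [] b → Dominates (0 ∷ []) b
dominates-[]⇒dominates-[0] dom zero = dom zero
dominates-[]⇒dominates-[0] dom (suc zero) = dom 1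
dominates-[]⇒dominates-[0] dom (suc (suc i)) = dom (suc (suc i))

dominates⇒fibEvenProd-≤-step : ∀ {b₁ b a₁ a} → All (_≤ b₁) b → (∀ a → Dominates a b → fibEvenProd b ≤ fibEvenProd a) →
  Dominates (a₁ ∷ a) (b₁ ∷ b) → fibEven b₁ * fibEvenProd b ≤ fibEven a₁ * fibEvenProd a
dominates⇒fibEvenProd-≤-step {b₁} {b} {a₁} {a} b≤b₁ ih dom with m≤n⇒∃[o]m+o≡n (+-cancelʳ-≤ 0 b₁ a₁ (dom 1))
... | d , refl = begin
  fibEven b₁ * fibEvenProd b            ≤⟨ *-monoʳ-≤ (fibEven b₁) (ih (bump b₁ d a) (dominates-bump b≤b₁ dom)) ⟩
  fibEven b₁ * fibEvenProd (bump b₁ d a) ≤⟨ fibEvenProd-bump b₁ d a ⟩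
  fibEven (b₁ + d) * fibEvenProd a       ∎
  where open ≤-Reasoning

dominates⇒fibEvenProd-≤ : ∀ {b} → AllPairs _≥_ b → ∀ a → Dominates a b → fibEvenProd b ≤ fibEvenProd a
dominates⇒fibEvenProd-≤ [] a _ = fibEvenProd-pos a
dominates⇒fibEvenProd-≤ (b≤b₁ ∷ desc) [] dom =
  dominates⇒fibEvenProd-≤-step b≤b₁ (dominates⇒fibEvenProd-≤ desc) (dominates-[]⇒dominates-[0] dom)
dominates⇒fibEvenProd-≤ (b≤b₁ ∷ desc) (a₁ ∷ a) dom =
  dominates⇒fibEvenProd-≤-step b≤b₁ (dominates⇒fibEvenProd-≤ desc) dom

dominates⇒fibEvenProd-< : ∀ {b} → AllPairs _≥_ b → All (0 <_) b → ∀ a → Dominates a b → head₀ b < head₀ a →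
  fibEvenProd b < fibEvenProd a
dominates⇒fibEvenProd-< [] [] (a₁ ∷ a) _ a₁>0 = *-mono-≤ (fibEven-≥2 a₁>0) (fibEvenProd-pos a)
dominates⇒fibEvenProd-< {b₁ ∷ b} (b≤b₁ ∷ desc) (b₁>0 ∷ b>0) (a₁ ∷ a) dom b₁<a₁ with m≤n⇒∃[o]m+o≡n (<⇒≤ b₁<a₁)
... | zero , b₁+0≡a₁ = ⊥-elim (<-irrefl (trans (sym (+-identityʳ b₁)) b₁+0≡a₁) b₁<a₁)
... | suc d′ , refl with fibEvenProd-bump-strict a b₁>0 z<s
...   | inj₁ bump-< = begin-strict
  fibEven b₁ * fibEvenProd b             ≤⟨ *-monoʳ-≤ (fibEven b₁) (dominates⇒fibEvenProd-≤ desc (bump b₁ (suc d′) a) (dominates-bump b≤b₁ dom)) ⟩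
  fibEven b₁ * fibEvenProd (bump b₁ (suc d′) a) <⟨ bump-< ⟩
  fibEven (b₁ + suc d′) * fibEvenProd a  ∎
  where open ≤-Reasoning
...   | inj₂ b₁<head = begin-strict
  fibEven b₁ * fibEvenProd b             <⟨ *-monoʳ-< (fibEven b₁) {{>-nonZero (fibEven-pos b₁)}}
                                              (dominates⇒fibEvenProd-< desc b>0 (bump b₁ (suc d′) a) (dominates-bump b≤b₁ dom)
                                                (≤-<-trans (head₀-≤ b≤b₁) b₁<head)) ⟩
  fibEven b₁ * fibEvenProd (bump b₁ (suc d′) a) ≤⟨ fibEvenProd-bump b₁ (suc d′) a ⟩
  fibEven (b₁ + suc d′) * fibEvenProd a  ∎
  where
  open ≤-Reasoning
  head₀-≤ : ∀ {xs} → All (_≤ b₁) xs → head₀ xs ≤ b₁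
  head₀-≤ [] = z≤n
  head₀-≤ (x≤b₁ ∷ _) = x≤b₁

sum-take≤sum : ∀ i xs → sum (take i xs) ≤ sum xs
sum-take≤sum i xs = begin
  sum (take i xs)                       ≤⟨ m≤m+n _ _ ⟩
  sum (take i xs) + sum (drop i xs)     ≡⟨ sum-++ (take i xs) (drop i xs) ⟨
  sum (take i xs ++ drop i xs)          ≡⟨ cong sum (take++drop≡id i xs) ⟩
  sum xs                                ∎
  where open ≤-Reasoning

majorizes⇒dominates : ∀ {ns ms} → ns ≻ ms → Dominates ns ms
majorizes⇒dominates {ns} {ms} (_ , prefix , total) i with i ≤? length ns
... | yes i≤|ns| = prefix i i≤|ns|
... | no i≰|ns| = begin
  sum (take i ms) ≤⟨ sum-take≤sum i ms ⟩
  sum ms          ≤⟨ total ⟩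
  sum ns          ≡⟨ cong sum (take-all i ns (<⇒≤ (≰⇒> i≰|ns|))) ⟨
  sum (take i ns) ∎
  where open ≤-Reasoning

majorizes-tail : ∀ {n ns ms} → (n ∷ ns) ≻ (n ∷ ms) → ns ≻ ms
majorizes-tail {n} (s≤s |ns|≤|ms| , prefix , total) =
  |ns|≤|ms| , (λ i i≤|ns| → +-cancelˡ-≤ n _ _ (prefix (suc i) (s≤s i≤|ns|))) , +-cancelˡ-≤ n _ _ total

strictlyDecreasing⇒nonincreasing : ∀ {xs} → Linked _>_ xs → AllPairs _≥_ xs
strictlyDecreasing⇒nonincreasing xs↓ = AllPairs.map <⇒≤ (Linked⇒AllPairs (flip <-trans) xs↓)

theorem3p5 : (ns ms : List ℕ) → StrictDecPos ns → StrictDecPos ms → ns ≻ ms →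
    fibEvenProd ns ≡ fibEvenProd ms → ns ≡ ms
theorem3p5 [] [] _ _ _ _ = refl
theorem3p5 [] (m ∷ ms) _ (m>0 ∷ _ , _) (_ , _ , total) _ =
  ⊥-elim (<-irrefl refl (<-≤-trans m>0 (≤-trans (m≤m+n m (sum ms)) total)))
theorem3p5 (n ∷ ns) [] _ _ (() , _) _
theorem3p5 (n ∷ ns) (m ∷ ms) (_ ∷ ns>0 , n>ns) (m>0 ∷ ms>0 , m>ms) n∷ns≻m∷ms eq
  with m≤n⇒m<n∨m≡n (+-cancelʳ-≤ 0 m n (majorizes⇒dominates n∷ns≻m∷ms 1))
... | inj₁ m<n = ⊥-elim (<-irrefl (sym eq)
  (dominates⇒fibEvenProd-< (strictlyDecreasing⇒nonincreasing m>ms) (m>0 ∷ ms>0) (n ∷ ns)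
    (majorizes⇒dominates n∷ns≻m∷ms) m<n))
... | inj₂ refl = cong (m ∷_) (theorem3p5 ns ms (ns>0 , Linked.tail n>ns) (ms>0 , Linked.tail m>ms)
  (majorizes-tail n∷ns≻m∷ms) (*-cancelˡ-≡ _ _ (fibEven m) {{>-nonZero (fibEven-pos m)}} eq))
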